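{- Let $G=(V,E)$ be a finite graph (either an arbitrary simple graph with a threshold $k(v)=k$ for all nodes, or a $p$-partite graph $G=(V_1,\ldots,V_p,E)$ with thresholds $k(v)=k_{p(v)}$ for $v\in V_{p(v)}$). When every node runs the distributed peeling protocol described below, the total number of messages sent is $O(|E|)$.
   Context: Distributed peeling protocol with thresholds $k(v)$: each node $v$ keeps a counter $degree$, initially $\deg_G(v)$, and a status, initially active. Initially (onInitial), if $degree<k(v)$, node $v$ sends an ``off'' message to each of its neighbors and becomes inactive; otherwise it waits. Whenever an active node $v$ receives an off message (onMessage), it decreases $degree$ by $1$, and if now $degree<k(v)$, it sends an off message to each of its neighbors and becomes inactive. An inactive node stays inactive and ignores all incoming messages. -}

module Defs where

open import Data.Nat using (ℕ; zero; suc; _+_; _*_; _∸_; _≤_; _<ᵇ_)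
open import Data.Bool using (Bool; true; false; _∧_; if_then_else_; not)
open import Data.Fin using (Fin; toℕ; _≟_)
open import Relation.Nullary using (yes; no)
open import Data.List using (List; []; _∷_; _++_; map; length; filterᵇ; allFin; cartesianProduct; concatMap; sum)
open import Data.Product using (_×_; _,_; Σ; ∃)
open import Relation.Binary.PropositionalEquality using (_≡_)
open import Relation.Binary.Construct.Closure.ReflexiveTransitive using (Star)

record Graph (n : ℕ) : Set where
  field
    adj   : Fin n → Fin n → Bool
    sym   : ∀ u v → adj u v ≡ adj v u
    irrefl : ∀ v → adj v v ≡ false

open Graph public

module _ {n : ℕ} (G : Graph n) where

  neighbours : Fin n → List (Fin n)
  neighbours v = filterᵇ (adj G v) (allFin n)

  deg : Fin n → ℕ
  deg v = length (neighbours v)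

  edgeCount : ℕ
  edgeCount = length (filterᵇ (λ p → adj G (Data.Product.proj₁ p) (Data.Product.proj₂ p)
                                      ∧ (toℕ (Data.Product.proj₁ p) <ᵇ toℕ (Data.Product.proj₂ p)))
                               (cartesianProduct (allFin n) (allFin n)))

-- The distributed peeling protocol, asynchronous semantics.
-- A message is an "off" message, recorded as (sender , receiver).

record NodeState : Set where
  constructor node
  field
    degree : ℕ
    active : Bool

open NodeState public

record Config (n : ℕ) : Set where
  constructor config
  field
    states  : Fin n → NodeState
    pending : List (Fin n × Fin n)
    sent    : ℕ

open Config public

module Protocol {n : ℕ} (G : Graph n) (k : Fin n → ℕ) where

  broadcast : Fin n → List (Fin n × Fin n)
  broadcast v = map (λ u → (v , u)) (neighbours G v)

  initOff : Fin n → Bool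
  initOff v = deg G v <ᵇ k v

  initState : Fin n → NodeState
  initState v = node (deg G v) (not (initOff v))

  initMsgs : Fin n → List (Fin n × Fin n)
  initMsgs v = if initOff v then broadcast v else []

  initial : Config n
  initial = config initState (concatMap initMsgs (allFin n)) (length (concatMap initMsgs (allFin n)))

  update : (Fin n → NodeState) → Fin n → NodeState → Fin n → NodeState
  update f v s w with v ≟ w
  ... | yes _ = s
  ... | no _  = f w

  -- onMessage: delivery of one pending message (in any order) to receiver t.
  -- The message is removed from the pending multiset.
  data Step : Config n → Config n → Set where
    deliver-inactive : ∀ {st xs ys s t m} →
      active (st t) ≡ false →
      Step (config st (xs ++ (s , t) ∷ ys) m) (config st (xs ++ ys) m)
    deliver-stay : ∀ {st xs ys s t m} →
      active (st t) ≡ true →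
      (degree (st t) ∸ 1 <ᵇ k t) ≡ false →
      Step (config st (xs ++ (s , t) ∷ ys) m)
           (config (update st t (node (degree (st t) ∸ 1) true)) (xs ++ ys) m)
    deliver-off : ∀ {st xs ys s t m} →
      active (st t) ≡ true →
      (degree (st t) ∸ 1 <ᵇ k t) ≡ true →
      Step (config st (xs ++ (s , t) ∷ ys) m)
           (config (update st t (node (degree (st t) ∸ 1) false))
                   (xs ++ ys ++ broadcast t) (m + length (broadcast t)))

  Reachable : Config n → Set
  Reachable c = Star Step initial c

-- Admissible threshold functions, as in the paper:
-- (i) uniform threshold k(v) = c on a simple graph, or
-- (ii) G is p-partite with parts given by part : Fin n → Fin p (no edges
--      inside a part) and k(v) = kp (part v).

UniformThreshold : ∀ {n} → (Fin n → ℕ) → Set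
UniformThreshold {n} k = Σ ℕ λ c → ∀ v → k v ≡ c

PartiteThreshold : ∀ {n} → Graph n → (Fin n → ℕ) → Set
PartiteThreshold {n} G k =
  Σ ℕ λ p → Σ (Fin n → Fin p) λ part → Σ (Fin p → ℕ) λ kp →
    (∀ u v → part u ≡ part v → adj G u v ≡ false) × (∀ v → k v ≡ kp (part v))

-- A node sends off messages only at the moment it becomes inactive, and then one to each
-- neighbour; it never becomes active again.  Hence at any time the number of messages sent
-- is at most the sum of the degrees of the inactive nodes, and so at most Σ deg = 2|E|.
module Submission where

open import Defs
open import Data.Bool using (Bool; true; false; _∧_; if_then_else_)
open import Data.Empty using (⊥-elim)
open import Data.Fin using (Fin; toℕ; _≟_)
open import Data.Fin.Properties using (toℕ-injective)
open import Data.List using (List; []; _∷_; _++_; map; length; filterᵇ; allFin; cartesianProduct; concatMap)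
open import Data.List.Membership.Propositional using (_∈_)
open import Data.List.Membership.Propositional.Properties using (∈-allFin)
open import Data.List.Properties using (length-map; length-++)
open import Data.List.Relation.Unary.Any using (here; there)
open import Data.Nat using (ℕ; zero; suc; _+_; _*_; _∸_; _≤_; _<ᵇ_; z≤n; s≤s)
open import Data.Nat.Properties
  using (≤-refl; ≤-reflexive; ≤-trans; +-mono-≤; +-assoc; +-comm; +-identityʳ; +-commutativeSemigroup; module ≤-Reasoning)
open import Algebra.Properties.CommutativeSemigroup +-commutativeSemigroup using (interchange)
open import Data.Product using (Σ; _×_; _,_)
open import Data.Sum using (_⊎_)
open import Relation.Binary.PropositionalEquality using (_≡_; _≢_; refl; trans; cong; cong₂; module ≡-Reasoning)
  renaming (sym to ≡-sym)
open import Relation.Binary.Construct.Closure.ReflexiveTransitive using (Star; ε; _◅_)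
open import Relation.Nullary using (yes; no)

⟦_⟧ : Bool → ℕ
⟦ true ⟧  = 1
⟦ false ⟧ = 0

∑ : {A : Set} → List A → (A → ℕ) → ℕ
∑ []       f = 0
∑ (x ∷ xs) f = f x + ∑ xs f

syntax ∑ xs (λ x → e) = ∑[ x ∈ xs ] e

module _ {A : Set} where

  ∑-++ : ∀ xs ys (f : A → ℕ) → ∑ (xs ++ ys) f ≡ ∑ xs f + ∑ ys f
  ∑-++ []       ys f = refl
  ∑-++ (x ∷ xs) ys f = trans (cong (f x +_) (∑-++ xs ys f)) (≡-sym (+-assoc (f x) _ _))

  ∑-cong : ∀ xs {f g : A → ℕ} → (∀ x → f x ≡ g x) → ∑ xs f ≡ ∑ xs g
  ∑-cong []       f≡g = refl
  ∑-cong (x ∷ xs) f≡g = cong₂ _+_ (f≡g x) (∑-cong xs f≡g)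

  ∑-mono : ∀ xs {f g : A → ℕ} → (∀ x → f x ≤ g x) → ∑ xs f ≤ ∑ xs g
  ∑-mono []       f≤g = z≤n
  ∑-mono (x ∷ xs) f≤g = +-mono-≤ (f≤g x) (∑-mono xs f≤g)

  ∑-distrib-+ : ∀ xs (f g : A → ℕ) → ∑[ x ∈ xs ] (f x + g x) ≡ ∑ xs f + ∑ xs g
  ∑-distrib-+ []       f g = refl
  ∑-distrib-+ (x ∷ xs) f g =
    trans (cong ((f x + g x) +_) (∑-distrib-+ xs f g)) (interchange (f x) (g x) _ _)

  ∑-mono-gain : ∀ {t xs} {f g : A → ℕ} d → t ∈ xs →
                (∀ x → f x ≤ g x) → f t + d ≤ g t → ∑ xs f + d ≤ ∑ xs g
  ∑-mono-gain {xs = x ∷ xs} {f} {g} d (here refl) f≤g gain = begin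
    (f x + ∑ xs f) + d ≡⟨ +-assoc (f x) _ d ⟩
    f x + (∑ xs f + d) ≡⟨ cong (f x +_) (+-comm (∑ xs f) d) ⟩
    f x + (d + ∑ xs f) ≡⟨ ≡-sym (+-assoc (f x) d _) ⟩
    (f x + d) + ∑ xs f ≤⟨ +-mono-≤ gain (∑-mono xs f≤g) ⟩
    g x + ∑ xs g       ∎
    where open ≤-Reasoning
  ∑-mono-gain {xs = x ∷ xs} {f} {g} d (there t∈xs) f≤g gain = begin
    (f x + ∑ xs f) + d ≡⟨ +-assoc (f x) _ d ⟩
    f x + (∑ xs f + d) ≤⟨ +-mono-≤ (f≤g x) (∑-mono-gain d t∈xs f≤g gain) ⟩
    g x + ∑ xs g       ∎
    where open ≤-Reasoning

  length-filterᵇ : ∀ (p : A → Bool) xs → length (filterᵇ p xs) ≡ ∑[ x ∈ xs ] ⟦ p x ⟧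
  length-filterᵇ p []       = refl
  length-filterᵇ p (x ∷ xs) with p x
  ... | true  = cong suc (length-filterᵇ p xs)
  ... | false = length-filterᵇ p xs

∑-map : ∀ {A B : Set} (g : A → B) xs (f : B → ℕ) → ∑ (map g xs) f ≡ ∑[ x ∈ xs ] f (g x)
∑-map g []       f = refl
∑-map g (x ∷ xs) f = cong (f (g x) +_) (∑-map g xs f)

module _ {A B : Set} where

  ∑-comm : ∀ xs ys (f : A → B → ℕ) → ∑[ x ∈ xs ] ∑[ y ∈ ys ] f x y ≡ ∑[ y ∈ ys ] ∑[ x ∈ xs ] f x y
  ∑-comm []       ys f = ≡-sym (∑-zero ys)
    where
    ∑-zero : ∀ (ys : List B) → ∑[ y ∈ ys ] 0 ≡ 0
    ∑-zero []       = refl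
    ∑-zero (y ∷ ys) = ∑-zero ys
  ∑-comm (x ∷ xs) ys f = trans (cong (∑ ys (f x) +_) (∑-comm xs ys f))
                               (≡-sym (∑-distrib-+ ys (f x) (λ y → ∑[ x′ ∈ xs ] f x′ y)))

  ∑-cartesianProduct : ∀ xs ys (f : A × B → ℕ) →
                       ∑ (cartesianProduct xs ys) f ≡ ∑[ x ∈ xs ] ∑[ y ∈ ys ] f (x , y)
  ∑-cartesianProduct []       ys f = refl
  ∑-cartesianProduct (x ∷ xs) ys f =
    trans (∑-++ (map (x ,_) ys) _ f) (cong₂ _+_ (∑-map (x ,_) ys f) (∑-cartesianProduct xs ys f))

  length-concatMap : ∀ (g : A → List B) xs → length (concatMap g xs) ≡ ∑[ x ∈ xs ] length (g x)
  length-concatMap g []       = refl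
  length-concatMap g (x ∷ xs) = trans (length-++ (g x)) (cong (length (g x) +_) (length-concatMap g xs))

<ᵇ-connex : ∀ m n → m ≢ n → 1 ≤ ⟦ m <ᵇ n ⟧ + ⟦ n <ᵇ m ⟧
<ᵇ-connex zero    zero    m≢n = ⊥-elim (m≢n refl)
<ᵇ-connex zero    (suc n) m≢n = s≤s z≤n
<ᵇ-connex (suc m) zero    m≢n = s≤s z≤n
<ᵇ-connex (suc m) (suc n) m≢n = <ᵇ-connex m n (λ m≡n → m≢n (cong suc m≡n))

module _ {n : ℕ} (G : Graph n) where

  vertices : List (Fin n)
  vertices = allFin n

  Oriented : Fin n → Fin n → ℕ
  Oriented u v = ⟦ adj G u v ∧ (toℕ u <ᵇ toℕ v) ⟧

  edgeCount-∑ : edgeCount G ≡ ∑[ u ∈ vertices ] ∑[ v ∈ vertices ] Oriented u v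
  edgeCount-∑ = trans (length-filterᵇ _ (cartesianProduct vertices vertices))
                      (∑-cartesianProduct vertices vertices _)

  -- Irreflexivity makes u ≢ v, so one of the two orientations of an edge is increasing.
  adj≤oriented : ∀ u v → ⟦ adj G u v ⟧ ≤ Oriented u v + Oriented v u
  adj≤oriented u v with adj G u v in uv | adj G v u in vu
  ... | false | _     = z≤n
  ... | true  | false with () ← trans (≡-sym vu) (trans (Graph.sym G v u) uv)
  ... | true  | true  = <ᵇ-connex (toℕ u) (toℕ v) (λ eq → u≢v (toℕ-injective eq))
    where
    u≢v : u ≢ v
    u≢v refl with () ← trans (≡-sym uv) (irrefl G u)

  ∑-deg≤2*edgeCount : ∑[ v ∈ vertices ] deg G v ≤ 2 * edgeCount G
  ∑-deg≤2*edgeCount = begin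
    ∑[ u ∈ vertices ] deg G u
      ≡⟨ ∑-cong vertices (λ u → length-filterᵇ (adj G u) vertices) ⟩
    ∑[ u ∈ vertices ] ∑[ v ∈ vertices ] ⟦ adj G u v ⟧
      ≤⟨ ∑-mono vertices (λ u → ∑-mono vertices (adj≤oriented u)) ⟩
    ∑[ u ∈ vertices ] ∑[ v ∈ vertices ] (Oriented u v + Oriented v u)
      ≡⟨ ∑-cong vertices (λ u → ∑-distrib-+ vertices (Oriented u) (λ v → Oriented v u)) ⟩
    ∑[ u ∈ vertices ] (∑[ v ∈ vertices ] Oriented u v + ∑[ v ∈ vertices ] Oriented v u)
      ≡⟨ ∑-distrib-+ vertices _ _ ⟩
    E + ∑[ u ∈ vertices ] ∑[ v ∈ vertices ] Oriented v u
      ≡⟨ cong (E +_) (∑-comm vertices vertices (λ u v → Oriented v u)) ⟩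
    E + E
      ≡⟨ cong (λ m → m + m) (≡-sym edgeCount-∑) ⟩
    edgeCount G + edgeCount G
      ≡⟨ cong (edgeCount G +_) (≡-sym (+-identityʳ _)) ⟩
    2 * edgeCount G
      ∎
    where
    open ≤-Reasoning
    E : ℕ
    E = ∑[ u ∈ vertices ] ∑[ v ∈ vertices ] Oriented u v

module _ {n : ℕ} (G : Graph n) (k : Fin n → ℕ) where
  open Protocol G k

  offDegree : Fin n → NodeState → ℕ
  offDegree v s = if active s then 0 else deg G v

  offDegrees : (Fin n → NodeState) → ℕ
  offDegrees st = ∑[ v ∈ vertices G ] offDegree v (st v)

  sent-initial : sent initial ≡ offDegrees initState
  sent-initial = trans (length-concatMap initMsgs (vertices G))
                       (∑-cong (vertices G) (λ v → initMsgs-length v (initOff v) refl))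
    where
    initMsgs-length : ∀ v b → initOff v ≡ b → length (initMsgs v) ≡ offDegree v (initState v)
    initMsgs-length v true  off rewrite off = length-map _ (neighbours G v)
    initMsgs-length v false off rewrite off = refl

  update-self : ∀ st t (s : NodeState) → update st t s t ≡ s
  update-self st t s with t ≟ t
  ... | yes _   = refl
  ... | no  t≢t = ⊥-elim (t≢t refl)

  offDegree-update : ∀ st t s → active (st t) ≡ true →
                     ∀ w → offDegree w (st w) ≤ offDegree w (update st t s w)
  offDegree-update st t s on w with t ≟ w
  ... | yes refl rewrite on = z≤n
  ... | no  _    = ≤-refl

  sent≤offDegrees-step : ∀ {c c′} → Step c c′ →
                         sent c ≤ offDegrees (states c) → sent c′ ≤ offDegrees (states c′)
  sent≤offDegrees-step (deliver-inactive _) bound = bound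
  sent≤offDegrees-step (deliver-stay {st} {t = t} on _) bound =
    ≤-trans bound (∑-mono (vertices G) (offDegree-update st t _ on))
  sent≤offDegrees-step (deliver-off {st} {t = t} {m} on _) bound = begin
    m + length (broadcast t) ≡⟨ cong (m +_) (length-map _ (neighbours G t)) ⟩
    m + deg G t              ≤⟨ +-mono-≤ bound ≤-refl ⟩
    offDegrees st + deg G t  ≤⟨ ∑-mono-gain (deg G t) (∈-allFin t) (offDegree-update st t s on) gain ⟩
    offDegrees (update st t s) ∎
    where
    open ≤-Reasoning
    s : NodeState
    s = node (degree (st t) ∸ 1) false
    gain : offDegree t (st t) + deg G t ≤ offDegree t (update st t s t)
    gain rewrite on | update-self st t s = ≤-refl

  sent≤offDegrees : ∀ {c} → Reachable c → sent c ≤ offDegrees (states c)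
  sent≤offDegrees = go (≤-reflexive sent-initial)
    where
    go : ∀ {c c′} → sent c ≤ offDegrees (states c) →
         Star Step c c′ → sent c′ ≤ offDegrees (states c′)
    go bound ε        = bound
    go bound (s ◅ ss) = go (sent≤offDegrees-step s bound) ss

  offDegrees≤∑-deg : ∀ st → offDegrees st ≤ ∑[ v ∈ vertices G ] deg G v
  offDegrees≤∑-deg st = ∑-mono (vertices G) (λ v → offDegree≤deg v (active (st v)))
    where
    offDegree≤deg : ∀ v b → (if b then 0 else deg G v) ≤ deg G v
    offDegree≤deg v true  = z≤n
    offDegree≤deg v false = ≤-refl

lemma1 : Σ ℕ λ C → ∀ (n : ℕ) (G : Graph n) (k : Fin n → ℕ) →
           UniformThreshold k ⊎ PartiteThreshold G k →
           ∀ (c : Config n) → Protocol.Reachable G k c →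
           sent c ≤ C * edgeCount G
lemma1 = 2 , λ n G k _ c reachable → begin
  sent c                           ≤⟨ sent≤offDegrees G k reachable ⟩
  offDegrees G k (states c)        ≤⟨ offDegrees≤∑-deg G k (states c) ⟩
  ∑[ v ∈ vertices G ] deg G v      ≤⟨ ∑-deg≤2*edgeCount G ⟩
  2 * edgeCount G                  ∎
  where open ≤-Reasoning
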